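{- Let $G$ be a graph, $W\subseteq Z\subseteq V(G)$, $d>0$, and suppose that $G$ $d$-expands into $W$. Then: (i) $G[Z]$ $d$-expands into $W$; (ii) if $d\geq 2$ then $G$ $d$-expands into $Z$; (iii) if $d>1$ and $d/(d-1)\leq c\leq d$ then $G$ $c$-expands into $W$.
   Context: For a graph $G$, a set $W\subseteq V(G)$ and $d>0$, we say $G$ $d$-expands into $W$ if (1) $|N(X)\cap W|\geq d|X|$ for all $X\subseteq V(G)$ with $1\leq|X|<\lceil |W|/(2d)\rceil$, and (2) $e(X,Y)>0$ (there is an edge between $X$ and $Y$) for all disjoint $X,Y\subseteq V(G)$ with $|X|=|Y|=\lceil|W|/(2d)\rceil$. Here $N(X)=\bigcup_{x\in X}N_G(x)\setminus X$. For a vertex subset $Z$, "$Z$ $d$-expands into $W$" refers to the induced subgraph $G[Z]$.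
   Formalization: The expansion parameters d and c range over the rationals. -}

module Defs where

open import Data.Bool using (Bool; true; false; _∧_; _∨_; not)
open import Data.Nat using (ℕ; zero; suc)
open import Data.Fin using (Fin)
import Data.Fin as Fin
open import Data.Fin.Subset using (Subset; _∈_; _∉_; _⊆_; _∩_; ∣_∣; ⊤)
open import Data.Vec using (tabulate; lookup)
open import Data.Integer using (ℤ; +_) renaming (_<_ to _<ℤ_)
open import Data.Rational using (ℚ; _/_; _÷_; _*_; _≤_; NonZero; ceiling)
open import Data.Product using (_×_; ∃; ∃-syntax)
open import Relation.Binary.PropositionalEquality using (_≡_)

record Graph (n : ℕ) : Set where
  field
    adj   : Fin n → Fin n → Bool
    sym   : ∀ u v → adj u v ≡ adj v u
    loopless : ∀ v → adj v v ≡ false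
open Graph public

anyFin : ∀ {n} → (Fin n → Bool) → Bool
anyFin {zero}  f = false
anyFin {suc n} f = f Fin.zero ∨ anyFin (λ i → f (Fin.suc i))

-- Neighbourhood of X in the induced subgraph G[Z]:
-- N(X) = { v ∈ Z \ X : v adjacent to some x ∈ X }   (X is assumed ⊆ Z)
N[_,_] : ∀ {n} → Graph n → Subset n → Subset n → Subset n
N[ G , Z ] X = tabulate λ v →
  lookup Z v ∧ not (lookup X v) ∧ anyFin (λ x → lookup X x ∧ adj G x v)

⟦_⟧ : ℕ → ℚ
⟦ k ⟧ = + k / 1

threshold : (W : ℕ) (d : ℚ) → .{{_ : NonZero d}} → ℤ
threshold w d = ceiling ((+ w / 2) ÷ d)

-- "Z d-expands into W" (i.e. G[Z] d-expands into W), for d > 0.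
ExpandsIn : ∀ {n} → Graph n → (Z : Subset n) → (d : ℚ) → .{{_ : NonZero d}} → (W : Subset n) → Set
ExpandsIn G Z d W =
  (∀ X → X ⊆ Z → 1 Data.Nat.≤ ∣ X ∣ → + ∣ X ∣ <ℤ threshold ∣ W ∣ d →
     d * ⟦ ∣ X ∣ ⟧ ≤ ⟦ ∣ N[ G , Z ] X ∩ W ∣ ⟧)
  × (∀ X Y → X ⊆ Z → Y ⊆ Z → (∀ v → v ∈ X → v ∉ Y) →
     + ∣ X ∣ ≡ threshold ∣ W ∣ d → + ∣ Y ∣ ≡ threshold ∣ W ∣ d →
     ∃[ x ] ∃[ y ] (x ∈ X × y ∈ Y × adj G x y ≡ true))

Expands : ∀ {n} → Graph n → (d : ℚ) → .{{_ : NonZero d}} → (W : Subset n) → Set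
Expands G d W = ExpandsIn G ⊤ d W

module Submission where

open import Defs
open import Data.Nat using (ℕ)
open import Data.Fin.Subset using (Subset; _⊆_)
open import Data.Rational using (ℚ; 0ℚ; 1ℚ; _<_; _≤_; _-_; _÷_; NonZero)
open import Data.Product using (_×_)

-- Neighbourhoods in G[Z] differ from those in G only by
--         vertices outside Z, hence outside W; the edge condition is unchanged.
--   (ii), (iii) both follow from one enlargement principle: if c ≤ d and
--         c + d ≤ c·d (i.e. 1/c + 1/d ≤ 1) then G c-expands into every S ⊇ W.
--         Since ⌈|S|/(2c)⌉ ≥ ⌈|W|/(2d)⌉, the edge condition for S follows from
--         that for W by passing to subsets.  A set X below the W-threshold
--         expands by hypothesis.  For a larger X, the residual set
--         R = S ∖ (X ∪ N(X)) has no edge to X, so it is below the W-threshold;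
--         then c|X| < |S|/2 and d|R| < |S|/2 force |X| + |R| < |S|/2, and
--         counting S ⊆ N(X) ∪ X ∪ R gives |N(X) ∩ S| > |S|/2 > c|X|.
--   Part (ii) is the case c = d ≥ 2 and part (iii) the case S = W.

open import Data.Nat using (zero; suc; z≤n; s≤s)
import Data.Nat as ℕ
import Data.Nat.Properties as ℕP
open import Data.Bool using (Bool; true; false; _∧_; not)
open import Data.Bool.Properties using (¬-not)
open import Data.Fin using (Fin)
import Data.Fin as Fin
open import Data.Fin.Subset using (_∈_; _∉_; _∩_; _∪_; ∁; ∣_∣; ⊤; ⊥; inside; outside)
open import Data.Fin.Subset.Properties
  using (⊥⊆; ⊆⊤; ∣⊥∣≡0; s⊆s; ⊆-trans; x∈p∩q⁺; x∈p∩q⁻; x∈p∪q⁺; x∈p∪q⁻; x∉p⇒x∈∁p; x∈∁p⇒x∉p; _∈?_;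
         p⊆q⇒∣p∣≤∣q∣)
open import Data.Vec using (_∷_; []; lookup)
open import Data.Vec.Properties using (lookup∘tabulate; lookup-replicate; []=⇒lookup; lookup⇒[]=)
open import Data.Integer as ℤ using (ℤ; +_; -[1+_]; +≤+; 0ℤ)
import Data.Integer.Properties as ℤP
import Data.Integer.DivMod as ℤD
open import Data.Integer.Tactic.RingSolver using (solve-∀)
open import Data.Rational
  using (mkℚ; ↥_; ↧_; _/_; _+_; _*_; -_; 1/_; floor; ceiling; Positive; NonNegative;
         positive; nonNegative; toℚᵘ; *<*)
open import Data.Rational.Properties
  using (toℚᵘ-fromℚᵘ; toℚᵘ-cancel-<; toℚᵘ-cancel-≤; toℚᵘ-injective; toℚᵘ-homo-+; ↥-neg; ↧-neg;
         normalize-nonNeg; nonNegative⁻¹; positive⁻¹; pos⇒nonNeg; pos*pos⇒pos; 1/pos⇒pos;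
         ≤-refl; ≤-trans; <-trans; <-≤-trans; <-irrefl; ≮⇒≥; +-mono-<; +-monoʳ-≤; +-monoˡ-<;
         *-comm; *-assoc; *-identityˡ; *-inverseʳ; *-zeroʳ; *-monoˡ-≤-nonNeg; *-monoʳ-≤-nonNeg;
         *-monoʳ-<-pos; *-cancelˡ-<-nonNeg)
open import Data.Rational.Solver using (module +-*-Solver)
open +-*-Solver using (solve; _:=_; _:+_; _:*_; _:-_; con)
open import Data.Rational.Unnormalised as ℚᵘ using (mkℚᵘ; *≡*) renaming (_≃_ to _≃ᵘ_)
import Data.Rational.Unnormalised.Properties as ℚᵘP
open import Data.Product using (_,_; proj₁; proj₂; ∃-syntax)
open import Data.Sum using (inj₁; inj₂)
open import Function using (_∘_)
open import Relation.Nullary using (¬_; yes; no)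
open import Relation.Binary.PropositionalEquality
  using (_≡_; refl; cong; cong₂; subst; trans; module ≡-Reasoning) renaming (sym to ≡-sym)

<⇒≱ : ∀ {p q} → p < q → ¬ (q ≤ p)
<⇒≱ p<q q≤p = <-irrefl refl (<-≤-trans p<q q≤p)

*-÷-cancel : ∀ a b .{{_ : NonZero b}} → b * (a ÷ b) ≡ a
*-÷-cancel a b = begin
  b * (a * 1/ b)   ≡⟨ cong (b *_) (*-comm a (1/ b)) ⟩
  b * (1/ b * a)   ≡⟨ *-assoc b (1/ b) a ⟨
  b * 1/ b * a     ≡⟨ cong (_* a) (*-inverseʳ b) ⟩
  1ℚ * a           ≡⟨ *-identityˡ a ⟩
  a                ∎
  where open ≡-Reasoning

÷-≤⇒≤-* : ∀ a b e .{{_ : NonZero b}} .{{_ : Positive b}} → a ÷ b ≤ e → a ≤ b * e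
÷-≤⇒≤-* a b e a÷b≤e = subst (_≤ b * e) (*-÷-cancel a b) (*-monoˡ-≤-nonNeg b {{pos⇒nonNeg b}} a÷b≤e)

<-÷⇒*-< : ∀ a b e .{{_ : NonZero b}} .{{_ : Positive b}} → e < a ÷ b → b * e < a
<-÷⇒*-< a b e e<a÷b = subst (b * e <_) (*-÷-cancel a b) (*-monoʳ-<-pos b e<a÷b)

sum-below : ∀ c d a b h .{{_ : Positive c}} .{{_ : Positive d}} → 0ℚ ≤ h → c + d ≤ c * d →
            c * a < h → d * b < h → a + b < h
sum-below c d a b h 0≤h c+d≤cd ca<h db<h =
  *-cancelˡ-<-nonNeg (c * d) {{pos⇒nonNeg (c * d) {{pos*pos⇒pos c d}}}} (begin-strict
    c * d * (a + b)            ≡⟨ solve 4 (λ c d a b → c :* d :* (a :+ b) := d :* (c :* a) :+ c :* (d :* b)) refl c d a b ⟩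
    d * (c * a) + c * (d * b)  <⟨ +-mono-< (*-monoʳ-<-pos d ca<h) (*-monoʳ-<-pos c db<h) ⟩
    d * h + c * h              ≡⟨ solve 3 (λ c d h → d :* h :+ c :* h := (c :+ d) :* h) refl c d h ⟩
    (c + d) * h                ≤⟨ *-monoʳ-≤-nonNeg h {{nonNegative 0≤h}} c+d≤cd ⟩
    c * d * h                  ∎)
  where open Data.Rational.Properties.≤-Reasoning

-- If m + e ≥ 2h while e < h, then m > h, so m bounds every x < h.
≤-of-complement : ∀ x e h m → x < h → e < h → h + h ≤ m + e → x ≤ m
≤-of-complement x e h m x<h e<h 2h≤m+e = ≮⇒≥ λ m<x →
  <⇒≱ (<-trans (+-mono-< m<x e<h) (+-monoˡ-< h x<h)) 2h≤m+e

two≤⇒+≤* : ∀ d .{{_ : Positive d}} → ⟦ 2 ⟧ ≤ d → d + d ≤ d * d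
two≤⇒+≤* d 2≤d = begin
  d + d        ≡⟨ solve 1 (λ d → d :+ d := d :* con ⟦ 2 ⟧) refl d ⟩
  d * ⟦ 2 ⟧    ≤⟨ *-monoˡ-≤-nonNeg d {{pos⇒nonNeg d}} 2≤d ⟩
  d * d        ∎
  where open Data.Rational.Properties.≤-Reasoning

>1⇒pred-pos : ∀ d → 1ℚ < d → Positive (d - 1ℚ)
>1⇒pred-pos d 1<d = positive (+-monoˡ-< (- 1ℚ) 1<d)

÷-pred-≤⇒+≤* : ∀ d c .{{_ : NonZero (d - 1ℚ)}} → 1ℚ < d → d ÷ (d - 1ℚ) ≤ c → c + d ≤ c * d
÷-pred-≤⇒+≤* d c 1<d d÷[d-1]≤c = begin
  c + d                ≤⟨ +-monoʳ-≤ c (÷-≤⇒≤-* d (d - 1ℚ) c {{_}} {{>1⇒pred-pos d 1<d}} d÷[d-1]≤c) ⟩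
  c + (d - 1ℚ) * c     ≡⟨ solve 2 (λ c d → c :+ (d :- con 1ℚ) :* c := c :* d) refl c d ⟩
  c * d                ∎
  where open Data.Rational.Properties.≤-Reasoning

÷-pred-≤⇒pos : ∀ d c .{{_ : NonZero (d - 1ℚ)}} .{{_ : Positive d}} → 1ℚ < d → d ÷ (d - 1ℚ) ≤ c → Positive c
÷-pred-≤⇒pos d c {{d-1≢0}} 1<d d÷[d-1]≤c = positive (<-≤-trans (positive⁻¹ (d ÷ (d - 1ℚ)) {{d÷[d-1]>0}}) d÷[d-1]≤c)
  where
  d÷[d-1]>0 : Positive (d ÷ (d - 1ℚ))
  d÷[d-1]>0 = pos*pos⇒pos d ((1/ (d - 1ℚ)) {{d-1≢0}}) {{1/pos⇒pos (d - 1ℚ) {{>1⇒pred-pos d 1<d}}}}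

toℚᵘ-/ : ∀ i k → toℚᵘ (i / suc k) ≃ᵘ mkℚᵘ i k
toℚᵘ-/ i k = toℚᵘ-fromℚᵘ (mkℚᵘ i k)

/1<-intro : ∀ i q → i ℤ.* ↧ q ℤ.< ↥ q → i / 1 < q
/1<-intro i q@(mkℚ _ _ _) i↧q<↥q =
  toℚᵘ-cancel-< (ℚᵘP.<-respˡ-≃ (ℚᵘP.≃-sym (toℚᵘ-/ i 0))
    (ℚᵘ.*<* (subst (i ℤ.* ↧ q ℤ.<_) (≡-sym (ℤP.*-identityʳ (↥ q))) i↧q<↥q)))

≤/1-intro : ∀ q i → ↥ q ℤ.≤ i ℤ.* ↧ q → q ≤ i / 1
≤/1-intro q@(mkℚ _ _ _) i ↥q≤i↧q =
  toℚᵘ-cancel-≤ (ℚᵘP.≤-respʳ-≃ (ℚᵘP.≃-sym (toℚᵘ-/ i 0))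
    (ℚᵘ.*≤* (subst (ℤ._≤ i ℤ.* ↧ q) (≡-sym (ℤP.*-identityʳ (↥ q))) ↥q≤i↧q)))

/-mono-≤ : ∀ k {i j} → i ℤ.≤ j → i / suc k ≤ j / suc k
/-mono-≤ k {i} {j} i≤j =
  toℚᵘ-cancel-≤ (ℚᵘP.≤-respˡ-≃ (ℚᵘP.≃-sym (toℚᵘ-/ i k)) (ℚᵘP.≤-respʳ-≃ (ℚᵘP.≃-sym (toℚᵘ-/ j k))
    (ℚᵘ.*≤* (ℤP.*-monoʳ-≤-nonNeg (+ suc k) i≤j))))

/1-homo-+ : ∀ i j → (i ℤ.+ j) / 1 ≡ i / 1 + j / 1
/1-homo-+ i j = toℚᵘ-injective (begin
  toℚᵘ ((i ℤ.+ j) / 1)             ≈⟨ toℚᵘ-/ (i ℤ.+ j) 0 ⟩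
  mkℚᵘ (i ℤ.+ j) 0                 ≈⟨ *≡* (numerators i j) ⟩
  mkℚᵘ i 0 ℚᵘ.+ mkℚᵘ j 0           ≈⟨ ℚᵘP.+-cong (ℚᵘP.≃-sym (toℚᵘ-/ i 0)) (ℚᵘP.≃-sym (toℚᵘ-/ j 0)) ⟩
  toℚᵘ (i / 1) ℚᵘ.+ toℚᵘ (j / 1)   ≈⟨ ℚᵘP.≃-sym (toℚᵘ-homo-+ (i / 1) (j / 1)) ⟩
  toℚᵘ (i / 1 + j / 1)             ∎)
  where
  open ℚᵘP.≃-Reasoning
  numerators : ∀ i j → (i ℤ.+ j) ℤ.* + 1 ≡ (i ℤ.* + 1 ℤ.+ j ℤ.* + 1) ℤ.* + 1
  numerators = solve-∀

/2-+-/2 : ∀ i → i / 2 + i / 2 ≡ i / 1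
/2-+-/2 i = toℚᵘ-injective (begin
  toℚᵘ (i / 2 + i / 2)             ≈⟨ toℚᵘ-homo-+ (i / 2) (i / 2) ⟩
  toℚᵘ (i / 2) ℚᵘ.+ toℚᵘ (i / 2)   ≈⟨ ℚᵘP.+-cong (toℚᵘ-/ i 1) (toℚᵘ-/ i 1) ⟩
  mkℚᵘ i 1 ℚᵘ.+ mkℚᵘ i 1           ≈⟨ *≡* (numerators i) ⟩
  mkℚᵘ i 0                         ≈⟨ ℚᵘP.≃-sym (toℚᵘ-/ i 0) ⟩
  toℚᵘ (i / 1)                     ∎)
  where
  open ℚᵘP.≃-Reasoning
  numerators : ∀ i → (i ℤ.* + 2 ℤ.+ i ℤ.* + 2) ℤ.* + 1 ≡ i ℤ.* + 4
  numerators = solve-∀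

floor-lower : ∀ p → floor p ℤ.* ↧ p ℤ.≤ ↥ p
floor-lower (mkℚ n d _) = ℤD.[n/d]*d≤n n (+ suc d)

floor-upper : ∀ p → ↥ p ℤ.< ℤ.suc (floor p) ℤ.* ↧ p
floor-upper (mkℚ n d _) =
  subst (λ f → n ℤ.< ℤ.suc f ℤ.* + suc d) (≡-sym (ℤD.div-pos-is-/ℕ n (suc d))) (ℤD.n<s[n/ℕd]*d n (suc d))

-- ⌈q⌉ = −⌊−q⌋ is the least integer i with ↥q ≤ i·↧q.
ceiling-upper : ∀ q → ↥ q ℤ.≤ ceiling q ℤ.* ↧ q
ceiling-upper q@(mkℚ _ _ _) = begin
  ↥ q                              ≡⟨ ≡-sym (ℤP.neg-involutive (↥ q)) ⟩
  ℤ.- (ℤ.- ↥ q)                    ≡⟨ cong ℤ.-_ (≡-sym (↥-neg q)) ⟩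
  ℤ.- ↥ (- q)                      ≤⟨ ℤP.neg-mono-≤ (floor-lower (- q)) ⟩
  ℤ.- (floor (- q) ℤ.* ↧ (- q))    ≡⟨ ℤP.neg-distribˡ-* (floor (- q)) (↧ (- q)) ⟩
  ℤ.- floor (- q) ℤ.* ↧ (- q)      ≡⟨ cong (ℤ.- floor (- q) ℤ.*_) (↧-neg q) ⟩
  ceiling q ℤ.* ↧ q                ∎
  where open ℤP.≤-Reasoning

ceiling-least : ∀ q i → i ℤ.< ceiling q → i ℤ.* ↧ q ℤ.< ↥ q
ceiling-least q@(mkℚ _ _ _) i i<⌈q⌉ = ℤP.neg-cancel-< (begin-strict
  ℤ.- ↥ q                            ≡⟨ ≡-sym (↥-neg q) ⟩
  ↥ (- q)                            <⟨ floor-upper (- q) ⟩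
  ℤ.suc (floor (- q)) ℤ.* ↧ (- q)    ≡⟨ cong (ℤ.suc (floor (- q)) ℤ.*_) (↧-neg q) ⟩
  ℤ.suc (floor (- q)) ℤ.* ↧ q        ≤⟨ ℤP.*-monoʳ-≤-nonNeg (↧ q) (ℤP.i<j⇒suc[i]≤j ⌊-q⌋<-i) ⟩
  ℤ.- i ℤ.* ↧ q                      ≡⟨ ≡-sym (ℤP.neg-distribˡ-* i (↧ q)) ⟩
  ℤ.- (i ℤ.* ↧ q)                    ∎)
  where
  open ℤP.≤-Reasoning
  ⌊-q⌋<-i : floor (- q) ℤ.< ℤ.- i
  ⌊-q⌋<-i = subst (ℤ._< ℤ.- i) (ℤP.neg-involutive (floor (- q))) (ℤP.neg-mono-< i<⌈q⌉)

⟦⟧-mono : ∀ {a b} → a ℕ.≤ b → ⟦ a ⟧ ≤ ⟦ b ⟧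
⟦⟧-mono a≤b = /-mono-≤ 0 (+≤+ a≤b)

⟦⟧-+ : ∀ a b → ⟦ a ℕ.+ b ⟧ ≡ ⟦ a ⟧ + ⟦ b ⟧
⟦⟧-+ a b = trans (cong (_/ 1) (ℤP.pos-+ a b)) (/1-homo-+ (+ a) (+ b))

⟦⟧-nonNeg : ∀ k → NonNegative ⟦ k ⟧
⟦⟧-nonNeg k = normalize-nonNeg k 1

half : ℕ → ℚ
half w = + w / 2

half-nonneg : ∀ w → 0ℚ ≤ half w
half-nonneg w = nonNegative⁻¹ (half w) {{normalize-nonNeg w 2}}

half-mono : ∀ {w s} → w ℕ.≤ s → half w ≤ half s
half-mono w≤s = /-mono-≤ 1 (+≤+ w≤s)

module _ (w : ℕ) (c : ℚ) .{{_ : NonZero c}} .{{_ : Positive c}} where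

  below-threshold : ∀ i → i ℤ.< threshold w c → c * (i / 1) < half w
  below-threshold i i<t = <-÷⇒*-< (half w) c (i / 1)
    (/1<-intro i (half w ÷ c) (ceiling-least (half w ÷ c) i i<t))

  reaches-threshold : ∀ i → threshold w c ℤ.≤ i → half w ≤ c * (i / 1)
  reaches-threshold i t≤i = ÷-≤⇒≤-* (half w) c (i / 1)
    (≤/1-intro (half w ÷ c) i (ℤP.≤-trans (ceiling-upper (half w ÷ c)) (ℤP.*-monoʳ-≤-nonNeg (↧ (half w ÷ c)) t≤i)))

  threshold-least : ∀ i → half w ≤ c * (i / 1) → threshold w c ℤ.≤ i
  threshold-least i w/2≤ci = ℤP.≮⇒≥ (λ i<t → <⇒≱ (below-threshold i i<t) w/2≤ci)

  -- The threshold is a natural number: a threshold ≤ −1 would force w/2 ≤ −c < 0.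
  threshold-nonneg : 0ℤ ℤ.≤ threshold w c
  threshold-nonneg = ℤP.≮⇒≥ λ t<0 →
    <⇒≱ c*[-1]<0 (≤-trans (half-nonneg w) (reaches-threshold -[1+ 0 ] (ℤP.i<j⇒i≤pred[j] t<0)))
    where
    c*[-1]<0 : c * (-[1+ 0 ] / 1) < 0ℚ
    c*[-1]<0 = subst (c * (-[1+ 0 ] / 1) <_) (*-zeroʳ c) (*-monoʳ-<-pos c (*<* ℤ.-<+))

threshold-antitone : ∀ {w s} c d .{{_ : NonZero c}} .{{_ : Positive c}} .{{_ : NonZero d}} .{{_ : Positive d}} →
                     w ℕ.≤ s → c ≤ d → threshold w d ℤ.≤ threshold s c
threshold-antitone {w} {s} c d w≤s c≤d = threshold-least w d tS (begin
  half w         ≤⟨ half-mono w≤s ⟩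
  half s         ≤⟨ reaches-threshold s c tS ℤP.≤-refl ⟩
  c * (tS / 1)   ≤⟨ *-monoʳ-≤-nonNeg (tS / 1) {{nonNegative (/-mono-≤ 0 (threshold-nonneg s c))}} c≤d ⟩
  d * (tS / 1)   ∎)
  where
  open Data.Rational.Properties.≤-Reasoning
  tS : ℤ
  tS = threshold s c

∣p∪q∣≤∣p∣+∣q∣ : ∀ {n} (p q : Subset n) → ∣ p ∪ q ∣ ℕ.≤ ∣ p ∣ ℕ.+ ∣ q ∣
∣p∪q∣≤∣p∣+∣q∣ []            []            = z≤n
∣p∪q∣≤∣p∣+∣q∣ (outside ∷ p) (outside ∷ q) = ∣p∪q∣≤∣p∣+∣q∣ p q
∣p∪q∣≤∣p∣+∣q∣ (outside ∷ p) (inside  ∷ q) =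
  subst (suc ∣ p ∪ q ∣ ℕ.≤_) (≡-sym (ℕP.+-suc ∣ p ∣ ∣ q ∣)) (s≤s (∣p∪q∣≤∣p∣+∣q∣ p q))
∣p∪q∣≤∣p∣+∣q∣ (inside  ∷ p) (outside ∷ q) = s≤s (∣p∪q∣≤∣p∣+∣q∣ p q)
∣p∪q∣≤∣p∣+∣q∣ (inside  ∷ p) (inside  ∷ q) =
  s≤s (ℕP.≤-trans (∣p∪q∣≤∣p∣+∣q∣ p q) (ℕP.+-monoʳ-≤ ∣ p ∣ (ℕP.n≤1+n ∣ q ∣)))

subset-of-size : ∀ {n} (p : Subset n) k → k ℕ.≤ ∣ p ∣ → ∃[ q ] (q ⊆ p × ∣ q ∣ ≡ k)
subset-of-size {n} p zero _ = ⊥ , ⊥⊆ , ∣⊥∣≡0 n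
subset-of-size (inside ∷ p) (suc k) (s≤s k≤∣p∣) with subset-of-size p k k≤∣p∣
... | q , q⊆p , ∣q∣≡k = inside ∷ q , s⊆s q⊆p , cong suc ∣q∣≡k
subset-of-size (outside ∷ p) (suc k) k<∣p∣ with subset-of-size p (suc k) k<∣p∣
... | q , q⊆p , ∣q∣≡k = outside ∷ q , s⊆s q⊆p , ∣q∣≡k

∩-monoʳ-⊆ : ∀ {n} (p : Subset n) {q r} → q ⊆ r → p ∩ q ⊆ p ∩ r
∩-monoʳ-⊆ p {q} q⊆r x∈p∩q with x∈p∩q⁻ p q x∈p∩q
... | x∈p , x∈q = x∈p∩q⁺ (x∈p , q⊆r x∈q)

anyFin-intro : ∀ {n} (f : Fin n → Bool) x → f x ≡ true → anyFin f ≡ true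
anyFin-intro f Fin.zero    fx≡true rewrite fx≡true = refl
anyFin-intro f (Fin.suc x) fx≡true with f Fin.zero
... | true  = refl
... | false = anyFin-intro (f ∘ Fin.suc) x fx≡true

∧-elimʳ : ∀ a {b} → a ∧ b ≡ true → b ≡ true
∧-elimʳ true b≡true = b≡true

module _ {n} (G : Graph n) where

  adjacentTo : Subset n → Fin n → Bool
  adjacentTo X v = anyFin (λ x → lookup X x ∧ adj G x v)

  ∈N-restrict : ∀ {Z₁ Z₂ X v} → v ∈ Z₁ → v ∈ N[ G , Z₂ ] X → v ∈ N[ G , Z₁ ] X
  ∈N-restrict {Z₁} {Z₂} {X} {v} v∈Z₁ v∈N = lookup⇒[]= v _ (begin
    lookup (N[ G , Z₁ ] X) v       ≡⟨ lookup∘tabulate _ v ⟩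
    lookup Z₁ v ∧ outsideAdjacent  ≡⟨ cong (_∧ outsideAdjacent) ([]=⇒lookup v∈Z₁) ⟩
    outsideAdjacent                ≡⟨ ∧-elimʳ (lookup Z₂ v) (trans (≡-sym (lookup∘tabulate _ v)) ([]=⇒lookup v∈N)) ⟩
    true                           ∎)
    where
    open ≡-Reasoning
    outsideAdjacent : Bool
    outsideAdjacent = not (lookup X v) ∧ adjacentTo X v

  ∈N-intro : ∀ {X x v} → x ∈ X → v ∉ X → adj G x v ≡ true → v ∈ N[ G , ⊤ ] X
  ∈N-intro {X} {x} {v} x∈X v∉X x~v = lookup⇒[]= v _ (begin
    lookup (N[ G , ⊤ ] X) v                          ≡⟨ lookup∘tabulate _ v ⟩
    lookup ⊤ v ∧ not (lookup X v) ∧ adjacentTo X v   ≡⟨ cong₂ (λ a b → a ∧ not b ∧ adjacentTo X v)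
                                                          (lookup-replicate v true) (¬-not (v∉X ∘ lookup⇒[]= v X)) ⟩
    adjacentTo X v                                   ≡⟨ anyFin-intro _ x (cong₂ _∧_ ([]=⇒lookup x∈X) x~v) ⟩
    true                                             ∎)
    where open ≡-Reasoning

Joined : ∀ {n} → Graph n → Subset n → Subset n → Set
Joined G X Y = ∃[ x ] ∃[ y ] (x ∈ X × y ∈ Y × adj G x y ≡ true)

Disjoint : ∀ {n} → Subset n → Subset n → Set
Disjoint X Y = ∀ v → v ∈ X → v ∉ Y

EdgeCondition : ∀ {n} → Graph n → Subset n → ℤ → Set
EdgeCondition G Z t = ∀ X Y → X ⊆ Z → Y ⊆ Z → Disjoint X Y → + ∣ X ∣ ≡ t → + ∣ Y ∣ ≡ t → Joined G X Y

-- The edge condition at size t joins all disjoint sets of size at least t,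
-- by applying it to subsets of size exactly t.
joined-above : ∀ {n} (G : Graph n) (Z : Subset n) {X Y t} → EdgeCondition G Z t → 0ℤ ℤ.≤ t →
               X ⊆ Z → Y ⊆ Z → Disjoint X Y → t ℤ.≤ + ∣ X ∣ → t ℤ.≤ + ∣ Y ∣ → Joined G X Y
joined-above G Z {X} {Y} edges (+≤+ _) X⊆Z Y⊆Z X∩Y=∅ (+≤+ {k} k≤∣X∣) (+≤+ k≤∣Y∣)
  with subset-of-size X k k≤∣X∣ | subset-of-size Y k k≤∣Y∣
... | X′ , X′⊆X , ∣X′∣≡k | Y′ , Y′⊆Y , ∣Y′∣≡k
  with edges X′ Y′ (⊆-trans X′⊆X X⊆Z) (⊆-trans Y′⊆Y Y⊆Z) (λ v v∈X′ → X∩Y=∅ v (X′⊆X v∈X′) ∘ Y′⊆Y)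
             (cong +_ ∣X′∣≡k) (cong +_ ∣Y′∣≡k)
... | x , y , x∈X′ , y∈Y′ , x~y = x , y , X′⊆X x∈X′ , Y′⊆Y y∈Y′ , x~y

module Residual {n} (G : Graph n) (S X : Subset n) where

  residual : Subset n
  residual = S ∩ ∁ (X ∪ N[ G , ⊤ ] X)

  residual-avoids : ∀ {v} → v ∈ residual → v ∉ X ∪ N[ G , ⊤ ] X
  residual-avoids v∈R = x∈∁p⇒x∉p (proj₂ (x∈p∩q⁻ S _ v∈R))

  residual-disjoint : Disjoint X residual
  residual-disjoint v v∈X v∈R = residual-avoids v∈R (x∈p∪q⁺ (inj₁ v∈X))

  residual-unjoined : ¬ Joined G X residual
  residual-unjoined (x , y , x∈X , y∈R , x~y) =
    residual-avoids y∈R (x∈p∪q⁺ (inj₂ (∈N-intro G x∈X (λ y∈X → residual-disjoint y y∈X y∈R) x~y)))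

  residual-cover : S ⊆ (N[ G , ⊤ ] X ∩ S) ∪ (X ∪ residual)
  residual-cover {v} v∈S with v ∈? X ∪ N[ G , ⊤ ] X
  ... | no v∉X∪N = x∈p∪q⁺ (inj₂ (x∈p∪q⁺ (inj₂ (x∈p∩q⁺ (v∈S , x∉p⇒x∈∁p v∉X∪N)))))
  ... | yes v∈X∪N with x∈p∪q⁻ X (N[ G , ⊤ ] X) v∈X∪N
  ...   | inj₁ v∈X = x∈p∪q⁺ (inj₂ (x∈p∪q⁺ (inj₁ v∈X)))
  ...   | inj₂ v∈N = x∈p∪q⁺ (inj₁ (x∈p∩q⁺ (v∈N , v∈S)))

  residual-count : ∣ S ∣ ℕ.≤ ∣ N[ G , ⊤ ] X ∩ S ∣ ℕ.+ (∣ X ∣ ℕ.+ ∣ residual ∣)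
  residual-count = begin
    ∣ S ∣                                                  ≤⟨ p⊆q⇒∣p∣≤∣q∣ residual-cover ⟩
    ∣ (N[ G , ⊤ ] X ∩ S) ∪ (X ∪ residual) ∣                ≤⟨ ∣p∪q∣≤∣p∣+∣q∣ (N[ G , ⊤ ] X ∩ S) (X ∪ residual) ⟩
    ∣ N[ G , ⊤ ] X ∩ S ∣ ℕ.+ ∣ X ∪ residual ∣              ≤⟨ ℕP.+-monoʳ-≤ ∣ N[ G , ⊤ ] X ∩ S ∣ (∣p∪q∣≤∣p∣+∣q∣ X residual) ⟩
    ∣ N[ G , ⊤ ] X ∩ S ∣ ℕ.+ (∣ X ∣ ℕ.+ ∣ residual ∣)      ∎
    where open ℕP.≤-Reasoning

-- Expansion into W inside Z₂ persists inside any Z₁ with W ⊆ Z₁ ⊆ Z₂: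
-- neighbours lost by the restriction lie outside Z₁, hence outside W.
expandsIn-restrict : ∀ {n} (G : Graph n) {W Z₁ Z₂ : Subset n} (d : ℚ) .{{_ : NonZero d}} →
                     W ⊆ Z₁ → Z₁ ⊆ Z₂ → ExpandsIn G Z₂ d W → ExpandsIn G Z₁ d W
expandsIn-restrict G {W} {Z₁} {Z₂} d W⊆Z₁ Z₁⊆Z₂ (expands , edges) = expands′ , edges′
  where
  expands′ : ∀ X → X ⊆ Z₁ → 1 ℕ.≤ ∣ X ∣ → + ∣ X ∣ ℤ.< threshold ∣ W ∣ d →
             d * ⟦ ∣ X ∣ ⟧ ≤ ⟦ ∣ N[ G , Z₁ ] X ∩ W ∣ ⟧
  expands′ X X⊆Z₁ 1≤∣X∣ small =
    ≤-trans (expands X (⊆-trans X⊆Z₁ Z₁⊆Z₂) 1≤∣X∣ small) (⟦⟧-mono (p⊆q⇒∣p∣≤∣q∣ N₂∩W⊆N₁∩W))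
    where
    N₂∩W⊆N₁∩W : N[ G , Z₂ ] X ∩ W ⊆ N[ G , Z₁ ] X ∩ W
    N₂∩W⊆N₁∩W v∈N₂∩W with x∈p∩q⁻ (N[ G , Z₂ ] X) W v∈N₂∩W
    ... | v∈N₂ , v∈W = x∈p∩q⁺ (∈N-restrict G {Z₂ = Z₂} {X} (W⊆Z₁ v∈W) v∈N₂ , v∈W)

  edges′ : EdgeCondition G Z₁ (threshold ∣ W ∣ d)
  edges′ X Y X⊆Z₁ Y⊆Z₁ = edges X Y (⊆-trans X⊆Z₁ Z₁⊆Z₂) (⊆-trans Y⊆Z₁ Z₁⊆Z₂)

module Enlargement {n} (G : Graph n) (W S : Subset n) (c d : ℚ)
  .{{_ : NonZero c}} .{{_ : Positive c}} .{{_ : NonZero d}} .{{_ : Positive d}}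
  (W⊆S : W ⊆ S) (c≤d : c ≤ d) (c+d≤cd : c + d ≤ c * d) (hyp : Expands G d W) where

  edgesW : EdgeCondition G ⊤ (threshold ∣ W ∣ d)
  edgesW = proj₂ hyp

  -- Sets of the S-threshold size are at least as large as the W-threshold.
  edges : EdgeCondition G ⊤ (threshold ∣ S ∣ c)
  edges X Y X⊆⊤ Y⊆⊤ X∩Y=∅ ∣X∣≡tS ∣Y∣≡tS =
    joined-above G ⊤ edgesW (threshold-nonneg ∣ W ∣ d) X⊆⊤ Y⊆⊤ X∩Y=∅ (above-tW ∣X∣≡tS) (above-tW ∣Y∣≡tS)
    where
    above-tW : ∀ {k} → + k ≡ threshold ∣ S ∣ c → threshold ∣ W ∣ d ℤ.≤ + k
    above-tW k≡tS = ℤP.≤-trans (threshold-antitone c d (p⊆q⇒∣p∣≤∣q∣ W⊆S) c≤d) (ℤP.≤-reflexive (≡-sym k≡tS))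

  small-expands : ∀ X → 1 ℕ.≤ ∣ X ∣ → + ∣ X ∣ ℤ.< threshold ∣ W ∣ d →
                  c * ⟦ ∣ X ∣ ⟧ ≤ ⟦ ∣ N[ G , ⊤ ] X ∩ S ∣ ⟧
  small-expands X 1≤∣X∣ small = begin
    c * ⟦ ∣ X ∣ ⟧              ≤⟨ *-monoʳ-≤-nonNeg ⟦ ∣ X ∣ ⟧ {{⟦⟧-nonNeg ∣ X ∣}} c≤d ⟩
    d * ⟦ ∣ X ∣ ⟧              ≤⟨ proj₁ hyp X ⊆⊤ 1≤∣X∣ small ⟩
    ⟦ ∣ N[ G , ⊤ ] X ∩ W ∣ ⟧   ≤⟨ ⟦⟧-mono (p⊆q⇒∣p∣≤∣q∣ (∩-monoʳ-⊆ (N[ G , ⊤ ] X) W⊆S)) ⟩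
    ⟦ ∣ N[ G , ⊤ ] X ∩ S ∣ ⟧   ∎
    where open Data.Rational.Properties.≤-Reasoning

  -- Sets between the two thresholds: the residual set R is not joined to X,
  -- so d|R| < |W|/2 ≤ |S|/2; with c|X| < |S|/2 this gives |X| + |R| < |S|/2,
  -- and |S| ≤ |N(X) ∩ S| + |X| + |R| leaves more than |S|/2 for N(X) ∩ S.
  large-expands : ∀ X → threshold ∣ W ∣ d ℤ.≤ + ∣ X ∣ → + ∣ X ∣ ℤ.< threshold ∣ S ∣ c →
                  c * ⟦ ∣ X ∣ ⟧ ≤ ⟦ ∣ N[ G , ⊤ ] X ∩ S ∣ ⟧
  large-expands X large below = ≤-of-complement (c * ⟦ x ⟧) (⟦ x ⟧ + ⟦ r ⟧) (half s) ⟦ m ⟧ cx<s/2 x+r<s/2 count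
    where
    open Residual G S X
    m x r s : ℕ
    m = ∣ N[ G , ⊤ ] X ∩ S ∣
    x = ∣ X ∣
    r = ∣ residual ∣
    s = ∣ S ∣

    r-small : + r ℤ.< threshold ∣ W ∣ d
    r-small = ℤP.≰⇒> λ tW≤r →
      residual-unjoined (joined-above G ⊤ edgesW (threshold-nonneg ∣ W ∣ d) ⊆⊤ ⊆⊤ residual-disjoint large tW≤r)

    cx<s/2 : c * ⟦ x ⟧ < half s
    cx<s/2 = below-threshold s c (+ x) below

    dr<s/2 : d * ⟦ r ⟧ < half s
    dr<s/2 = <-≤-trans (below-threshold ∣ W ∣ d (+ r) r-small) (half-mono (p⊆q⇒∣p∣≤∣q∣ W⊆S))

    x+r<s/2 : ⟦ x ⟧ + ⟦ r ⟧ < half s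
    x+r<s/2 = sum-below c d ⟦ x ⟧ ⟦ r ⟧ (half s) (half-nonneg s) c+d≤cd cx<s/2 dr<s/2

    count : half s + half s ≤ ⟦ m ⟧ + (⟦ x ⟧ + ⟦ r ⟧)
    count = begin
      half s + half s            ≡⟨ /2-+-/2 (+ s) ⟩
      ⟦ s ⟧                      ≤⟨ ⟦⟧-mono residual-count ⟩
      ⟦ m ℕ.+ (x ℕ.+ r) ⟧        ≡⟨ ⟦⟧-+ m (x ℕ.+ r) ⟩
      ⟦ m ⟧ + ⟦ x ℕ.+ r ⟧        ≡⟨ cong (λ q → ⟦ m ⟧ + q) (⟦⟧-+ x r) ⟩
      ⟦ m ⟧ + (⟦ x ⟧ + ⟦ r ⟧)    ∎
      where open Data.Rational.Properties.≤-Reasoning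

  expands : Expands G c S
  expands = expand , edges
    where
    expand : ∀ X → X ⊆ ⊤ → 1 ℕ.≤ ∣ X ∣ → + ∣ X ∣ ℤ.< threshold ∣ S ∣ c →
             c * ⟦ ∣ X ∣ ⟧ ≤ ⟦ ∣ N[ G , ⊤ ] X ∩ S ∣ ⟧
    expand X _ 1≤∣X∣ below with + ∣ X ∣ ℤP.<? threshold ∣ W ∣ d
    ... | yes small = small-expands X 1≤∣X∣ small
    ... | no ¬small = large-expands X (ℤP.≮⇒≥ ¬small) below

lemma4p3 : ∀ {n} (G : Graph n) (W Z : Subset n) (d : ℚ) .{{_ : NonZero d}} →
    0ℚ < d → W ⊆ Z → Expands G d W →
    ExpandsIn G Z d W
    × (⟦ 2 ⟧ ≤ d → Expands G d Z)
    × (1ℚ < d → .{{_ : NonZero (d - 1ℚ)}} → ∀ (c : ℚ) .{{_ : NonZero c}} →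
    d ÷ (d - 1ℚ) ≤ c → c ≤ d → Expands G c W)
lemma4p3 G W Z d 0<d W⊆Z hyp = restricted , enlarged , weakened
  where
  instance
    d>0 : Positive d
    d>0 = positive 0<d

  restricted : ExpandsIn G Z d W
  restricted = expandsIn-restrict G d W⊆Z ⊆⊤ hyp

  enlarged : ⟦ 2 ⟧ ≤ d → Expands G d Z
  enlarged 2≤d = Enlargement.expands G W Z d d W⊆Z ≤-refl (two≤⇒+≤* d 2≤d) hyp

  weakened : 1ℚ < d → .{{_ : NonZero (d - 1ℚ)}} → ∀ (c : ℚ) .{{_ : NonZero c}} →
             d ÷ (d - 1ℚ) ≤ c → c ≤ d → Expands G c W
  weakened 1<d c d÷[d-1]≤c c≤d =
    Enlargement.expands G W W c d {{_}} {{÷-pred-≤⇒pos d c 1<d d÷[d-1]≤c}} (λ w∈W → w∈W) c≤d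
      (÷-pred-≤⇒+≤* d c 1<d d÷[d-1]≤c) hyp
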